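{- Let $I=(a..c)$ be a conserved interval of $\mathcal{P}$ and let $F$ be a set of frontiers of $I$. Then, in each permutation $P_k\in\mathcal{P}$, the elements of $F$ either all appear with sign $+$ or all appear with sign $-$.
   Context: Let $n\ge 2$, $K\ge1$, and let $\mathcal{P}=\{P_1,\ldots,P_K\}$ be a set of signed permutations of $\{1,\ldots,n\}$: each $P_k$ is a sequence in which each of $1,\ldots,n$ appears exactly once, with a sign $+$ or $-$. Assume each $P_k$ begins with $+1$ and ends with $+n$, and $P_1=\mathrm{Id}_n$ (identity order, all signs $+$). For $i\le j$, $(i..j)=\{i,\ldots,j\}$. A conserved interval of $\mathcal{P}$ is either a singleton, or a set $(a..c)$ with $a<c$ such that in every $P_k$ the elements of $(a..c)$ (ignoring signs) occupy consecutive positions and this block is delimited either by $+a$ on the left and $+c$ on the right, or by $-c$ on the left and $-a$ on the right. For a conserved interval $I=(a..c)$, a set $\{f_1,\ldots,f_k\}$ of elements with $a=f_1<f_2<\cdots<f_k=c$ is a set of frontiers of $I$ if $(f_i..f_j)$ is a conserved interval for all $1\le i<j\le k$. -}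

module Defs where

open import Data.Nat using (ℕ; _≤_; _<_; _∸_)
open import Data.Fin using (Fin; toℕ)
open import Data.Fin.Subset using (Subset; _∈_)
open import Data.Product using (Σ; _×_; ∃)
open import Data.Sum using (_⊎_)
open import Relation.Binary.PropositionalEquality using (_≡_)
open import Function using (_⇔_)
open import Function.Definitions using (Injective)

-- Convention: the elements 1..n of the paper are represented by Fin n,
-- element i (paper) ↔ the Fin n value with toℕ = i - 1 (order preserved).
-- Positions 1..n of a sequence are likewise represented by Fin n.

data Sign : Set where
  plus minus : Sign

-- A signed permutation of n elements: at position p sits element (at p)
-- carrying sign (sg p). 'at' is injective, hence a bijection of Fin n.
record SignedPerm (n : ℕ) : Set where
  field
    at     : Fin n → Fin n
    sg     : Fin n → Sign
    at-inj : Injective _≡_ _≡_ at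
open SignedPerm public

HasSign : ∀ {n} → SignedPerm n → Fin n → Sign → Set
HasSign P x s = ∀ p → at P p ≡ x → sg P p ≡ s

BeginsEndsPlus : ∀ {n} → SignedPerm n → Set
BeginsEndsPlus {n} P =
  (∀ p → toℕ p ≡ 0 → toℕ (at P p) ≡ 0 × sg P p ≡ plus) ×
  (∀ p → toℕ p ≡ n ∸ 1 → toℕ (at P p) ≡ n ∸ 1 × sg P p ≡ plus)

IsIdentity : ∀ {n} → SignedPerm n → Set
IsIdentity P = ∀ p → at P p ≡ p × sg P p ≡ plus

Block : ∀ {n} → SignedPerm n → Fin n → Fin n → Set
Block {n} P a c =
  Σ (Fin n) λ l → Σ (Fin n) λ r →
    (∀ p → (toℕ l ≤ toℕ p × toℕ p ≤ toℕ r) ⇔ (toℕ a ≤ toℕ (at P p) × toℕ (at P p) ≤ toℕ c)) ×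
    ((at P l ≡ a × sg P l ≡ plus × at P r ≡ c × sg P r ≡ plus) ⊎
     (at P l ≡ c × sg P l ≡ minus × at P r ≡ a × sg P r ≡ minus))

Conserved : ∀ {n K} → (Fin K → SignedPerm n) → Fin n → Fin n → Set
Conserved 𝒫 a c = a ≡ c ⊎ (toℕ a < toℕ c × (∀ k → Block (𝒫 k) a c))

Frontiers : ∀ {n K} → (Fin K → SignedPerm n) → Fin n → Fin n → Subset n → Set
Frontiers {n} 𝒫 a c F =
  a ∈ F × c ∈ F ×
  (∀ f → f ∈ F → toℕ a ≤ toℕ f × toℕ f ≤ toℕ c) ×
  (∀ f g → f ∈ F → g ∈ F → toℕ f < toℕ g → Conserved 𝒫 f g)

-- If a < f are both frontiers then (a..f) is conserved, so in every P_k the block of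
-- (a..f) is delimited by a and f carrying one and the same sign; hence every frontier
-- carries the sign of a.
module Submission where

open import Defs
open import Data.Nat using (ℕ; _≤_; suc)
open import Data.Nat.Properties using (≤∧≢⇒<)
open import Data.Fin using (Fin; zero)
open import Data.Fin.Properties using (any?; _≟_; toℕ-injective)
open import Data.Fin.Subset using (Subset; _∈_)
open import Data.Sum using (_⊎_; inj₁; inj₂)
open import Data.Product using (∃; _×_; _,_; proj₁; proj₂)
open import Data.Empty using (⊥-elim)
open import Relation.Nullary using (yes; no)
open import Relation.Binary.PropositionalEquality using (_≡_; _≢_; refl; sym; trans; cong; subst)

module _ {n : ℕ} (P : SignedPerm n) where

  HasSign-at : ∀ {p x} → at P p ≡ x → HasSign P x (sg P p)
  HasSign-at eq q eq′ = cong (sg P) (at-inj P (trans eq′ (sym eq)))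

  -- No surjectivity of at is needed: an element occurring nowhere has every sign vacuously.
  hasSome-sign : ∀ x → ∃ (HasSign P x)
  hasSome-sign x with any? (λ p → at P p ≟ x)
  ... | yes (p , eq) = sg P p , HasSign-at eq
  ... | no absent    = plus , λ p eq → ⊥-elim (absent (p , eq))

  Block⇒sign-of-right : ∀ {a c} → Block P a c → ∃ λ p → at P p ≡ a × HasSign P c (sg P p)
  Block⇒sign-of-right (l , r , _ , inj₁ (el , sl , er , sr)) =
    l , el , subst (HasSign P _) (trans sr (sym sl)) (HasSign-at er)
  Block⇒sign-of-right (l , r , _ , inj₂ (el , sl , er , sr)) =
    r , er , subst (HasSign P _) (trans sl (sym sr)) (HasSign-at el)

  Block⇒same-sign : ∀ {a c s} → Block P a c → HasSign P a s → HasSign P c s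
  Block⇒same-sign block a∶s with p , ep , c∶sp ← Block⇒sign-of-right block =
    subst (HasSign P _) (a∶s p ep) c∶sp

module _ {n K : ℕ} {𝒫 : Fin K → SignedPerm n} {a c : Fin n} {F : Subset n}
         (frontiers : Frontiers 𝒫 a c F) where

  private
    a∈F = proj₁ frontiers
    inside = proj₁ (proj₂ (proj₂ frontiers))
    conserved = proj₂ (proj₂ (proj₂ frontiers))

  frontier-block : ∀ {f} → f ∈ F → f ≢ a → ∀ k → Block (𝒫 k) a f
  frontier-block {f} f∈F f≢a with conserved a f a∈F f∈F a<f
    where a<f = ≤∧≢⇒< (proj₁ (inside f f∈F)) (λ eq → f≢a (sym (toℕ-injective eq)))
  ... | inj₁ a≡f        = ⊥-elim (f≢a (sym a≡f))
  ... | inj₂ (_ , block) = block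

  frontiers-same-sign : ∀ k {s} → HasSign (𝒫 k) a s → ∀ f → f ∈ F → HasSign (𝒫 k) f s
  frontiers-same-sign k a∶s f f∈F with f ≟ a
  ... | yes refl = a∶s
  ... | no f≢a   = Block⇒same-sign (𝒫 k) (frontier-block f∈F f≢a k) a∶s

lemma6 : (n K : ℕ) → 2 ≤ n → (𝒫 : Fin (suc K) → SignedPerm n) →
    (∀ k → BeginsEndsPlus (𝒫 k)) → IsIdentity (𝒫 zero) →
    (a c : Fin n) → Conserved 𝒫 a c →
    (F : Subset n) → Frontiers 𝒫 a c F →
    ∀ k → (∀ f → f ∈ F → HasSign (𝒫 k) f plus) ⊎
    (∀ f → f ∈ F → HasSign (𝒫 k) f minus)
lemma6 n K _ 𝒫 _ _ a c _ F frontiers k with hasSome-sign (𝒫 k) a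
... | plus  , a∶+ = inj₁ (frontiers-same-sign {𝒫 = 𝒫} {a} {c} {F} frontiers k a∶+)
... | minus , a∶− = inj₂ (frontiers-same-sign {𝒫 = 𝒫} {a} {c} {F} frontiers k a∶−)
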